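{- Let $X_0$ be a finite connected graph and $h\ge0$. There are only finitely many vanishing subgroups $H\subset H_1(X_0,\mathbb{Z})$ such that (1) $\mathrm{rank}\,H_1(X_0,\mathbb{Z})/H=2$ and (2) $h(H)\le h$.
   Context: Fix an orientation $E_0^o$ of $X_0$ (one direction of each edge). For a $1$-chain $\alpha=\sum_{e\in E_0^o}a_e e$ set $\|\alpha\|_1=\sum_{e\in E_0^o}|a_e|$ (independent of the orientation). A vanishing subgroup is a direct summand $H$ of $H_1(X_0,\mathbb{Z})$. For a $\mathbb{Z}$-basis $S=\{\alpha_1,\dots,\alpha_{b-2}\}$ of such an $H$ (with $b=b_1(X_0)$) put $h(S)=\max_i\|\alpha_i\|_1$, and define the height $h(H)=\min_S h(S)$ over all $\mathbb{Z}$-bases $S$ of $H$. -}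

module Defs where

open import Level using (0ℓ) renaming (suc to lsuc)
open import Data.Nat as ℕ using (ℕ; zero; suc; _∸_; _≤_)
open import Data.Integer as ℤ using (ℤ; +_; ∣_∣; -_; 0ℤ; 1ℤ) renaming (_+_ to _+ℤ_; _*_ to _*ℤ_; _-_ to _-ℤ_)
open import Data.Fin using (Fin; _≟_)
open import Data.Vec using (Vec; []; _∷_; lookup; tabulate; zipWith; map; replicate; foldr)
open import Data.Vec.Relation.Unary.All using (All)
open import Data.List using (List)
open import Data.List.Membership.Propositional using (_∈_)
open import Data.Product using (Σ; ∃; _×_; _,_)
open import Data.Bool using (if_then_else_)
open import Relation.Nullary using (¬_)
open import Relation.Nullary.Decidable using (⌊_⌋)
open import Relation.Binary.PropositionalEquality using (_≡_)

-- A finite graph (multi-edges and loops allowed) with a fixed orientation E₀ᵒ: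
-- vertices Fin nV, oriented edges Fin nE, edge e goes from src e to tgt e.
record Graph : Set where
  field
    nV   : ℕ
    nE   : ℕ
    src  : Fin nE → Fin nV
    tgt  : Fin nE → Fin nV
open Graph public

data Reach (G : Graph) : Fin (nV G) → Fin (nV G) → Set where
  here : ∀ {v} → Reach G v v
  fwd  : ∀ {v} (e : Fin (nE G)) → Reach G (tgt G e) v → Reach G (src G e) v
  bwd  : ∀ {v} (e : Fin (nE G)) → Reach G (src G e) v → Reach G (tgt G e) v

Connected : Graph → Set
Connected G = ∀ u v → Reach G u v

Chain : Graph → Set
Chain G = Vec ℤ (nE G)

sumℤ : ∀ {k} → Vec ℤ k → ℤ
sumℤ = foldr _ _+ℤ_ 0ℤ

δ : ∀ {n} → Fin n → Fin n → ℤ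
δ i j = if ⌊ i ≟ j ⌋ then 1ℤ else 0ℤ

∂ : (G : Graph) → Chain G → Vec ℤ (nV G)
∂ G α = tabulate λ v →
  sumℤ (tabulate λ e → lookup α e *ℤ (δ (tgt G e) v -ℤ δ (src G e) v))

-- H₁(X₀,ℤ) = Z₁ = ker ∂ (a graph has no 2-cells)
IsCycle : (G : Graph) → Chain G → Set
IsCycle G α = ∂ G α ≡ replicate _ 0ℤ

zeroC : (G : Graph) → Chain G
zeroC G = replicate _ 0ℤ

_⊕_ : ∀ {n} → Vec ℤ n → Vec ℤ n → Vec ℤ n
α ⊕ β = zipWith _+ℤ_ α β

_·_ : ∀ {n} → ℤ → Vec ℤ n → Vec ℤ n
a · α = map (a *ℤ_) α

neg : ∀ {n} → Vec ℤ n → Vec ℤ n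
neg α = map -_ α

norm1 : ∀ {n} → Vec ℤ n → ℕ
norm1 α = foldr _ ℕ._+_ 0 (map ∣_∣ α)

lincomb : ∀ {n k} → Vec ℤ k → Vec (Vec ℤ n) k → Vec ℤ n
lincomb [] [] = replicate _ 0ℤ
lincomb (a ∷ as) (α ∷ αs) = (a · α) ⊕ lincomb as αs

record Subgroup (G : Graph) : Set₁ where
  field
    mem    : Chain G → Set
    zero∈  : mem (zeroC G)
    ⊕∈     : ∀ {x y} → mem x → mem y → mem (x ⊕ y)
    neg∈   : ∀ {x} → mem x → mem (neg x)
open Subgroup public

SubgroupOfH1 : ∀ {G} → Subgroup G → Set
SubgroupOfH1 {G} H = ∀ x → mem H x → IsCycle G x

_≈S_ : ∀ {G} → Subgroup G → Subgroup G → Set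
_≈S_ {G} H K = ∀ x → (mem H x → mem K x) × (mem K x → mem H x)

IsBasis : ∀ {n k} → (Vec ℤ n → Set) → Vec (Vec ℤ n) k → Set
IsBasis {n} {k} P S =
  All P S
  × (∀ x → P x → ∃ λ (c : Vec ℤ k) → x ≡ lincomb c S)
  × (∀ (c : Vec ℤ k) → lincomb c S ≡ replicate _ 0ℤ → c ≡ replicate _ 0ℤ)

IsDirectSummand : ∀ {G} → Subgroup G → Set₁
IsDirectSummand {G} H =
  ∃ λ (K : Subgroup G) →
    SubgroupOfH1 K
    × (∀ x → mem H x → mem K x → x ≡ zeroC G)
    × (∀ z → IsCycle G z → ∃ λ p → ∃ λ q → mem H p × mem K q × z ≡ p ⊕ q)

IsVanishing : ∀ {G} → Subgroup G → Set₁
IsVanishing H = SubgroupOfH1 H × IsDirectSummand H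

-- rank (H₁(X₀,ℤ)/H) = r : there are r classes in H₁/H that are ℤ-linearly
-- independent, and every class has a nonzero multiple in their span
-- (torsion-free rank, i.e. dim_ℚ of (H₁/H) ⊗ ℚ).
QuotientRank : ∀ {G} → Subgroup G → ℕ → Set
QuotientRank {G} H r =
  ∃ λ (c : Vec (Chain G) r) →
    All (IsCycle G) c
    × (∀ (a : Vec ℤ r) → mem H (lincomb a c) → a ≡ replicate _ 0ℤ)
    × (∀ z → IsCycle G z →
         ∃ λ (N : ℤ) → ¬ (N ≡ 0ℤ) × ∃ λ (a : Vec ℤ r) → ∃ λ p →
           mem H p × (N · z) ≡ lincomb a c ⊕ p)

-- h(H) ≤ h, where b = b₁(X₀): some ℤ-basis S of H with b−2 elements has max ‖αᵢ‖₁ ≤ h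
HeightLE : ∀ {G} → (b : ℕ) → Subgroup G → ℕ → Set
HeightLE {G} b H h =
  ∃ λ (S : Vec (Chain G) (b ∸ 2)) → IsBasis (mem H) S × All (λ α → norm1 α ≤ h) S

BettiIs : (G : Graph) → ℕ → Set
BettiIs G b = ∃ λ (S : Vec (Chain G) b) → IsBasis (IsCycle G) S

module Submission where

-- A vanishing subgroup H with h(H) ≤ h has a ℤ-basis
-- S = (α₁,…,α_{b−2}) of 1-chains with ‖αᵢ‖₁ ≤ h, and H is then recovered from
-- S alone as the subgroup it generates.  A chain of ℓ¹-norm ≤ h has every
-- coordinate in [−h, h], so there are only finitely many such chains on the
-- fixed edge set, hence finitely many candidate tuples S, hence finitely many
-- subgroups "span of S".

open import Defs
open import Data.Nat using (ℕ; zero; suc; _≤_; _∸_; s≤s)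
import Data.Nat.Properties as ℕP
open import Data.Integer using (ℤ; +_; -[1+_]; ∣_∣; 0ℤ; -_) renaming (_+_ to _+ℤ_; _*_ to _*ℤ_)
import Data.Integer.Properties as ℤP
open import Data.List using (List; []; _∷_; [_]; map; cartesianProductWith)
open import Data.List.Membership.Propositional using (_∈_)
open import Data.List.Membership.Propositional.Properties using (∈-map⁺; ∈-cartesianProductWith⁺)
open import Data.List.Relation.Unary.Any using (here; there)
open import Data.Vec using (Vec; []; _∷_; replicate; lookup)
open import Data.Vec.Properties using (tabulate∘lookup)
open import Data.Vec.Relation.Unary.All using (All; []; _∷_)
open import Data.Vec.Relation.Unary.All.Properties using (tabulate⁺; lookup⁺)
open import Data.Product using (∃; _×_; _,_)
open import Relation.Binary.PropositionalEquality using (_≡_; refl; sym; trans; cong; cong₂; subst)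
open import Relation.Nullary using (yes; no)

zero-· : ∀ {n} (α : Vec ℤ n) → (+ 0) · α ≡ replicate n 0ℤ
zero-· [] = refl
zero-· (x ∷ α) = cong (0ℤ ∷_) (zero-· α)

suc-· : ∀ {n} m (α : Vec ℤ n) → (+ suc m) · α ≡ α ⊕ ((+ m) · α)
suc-· m [] = refl
suc-· m (x ∷ α) = cong₂ _∷_ coordinate (suc-· m α)
  where
  coordinate : + suc m *ℤ x ≡ x +ℤ + m *ℤ x
  coordinate = trans (ℤP.*-distribʳ-+ x (+ 1) (+ m)) (cong (_+ℤ (+ m *ℤ x)) (ℤP.*-identityˡ x))

negsuc-· : ∀ {n} m (α : Vec ℤ n) → -[1+ m ] · α ≡ neg ((+ suc m) · α)
negsuc-· m [] = refl
negsuc-· m (x ∷ α) = cong₂ _∷_ (sym (ℤP.neg-distribˡ-* (+ suc m) x)) (negsuc-· m α)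

module _ {G : Graph} (H : Subgroup G) where

  ℕ·-closed : ∀ m {α} → mem H α → mem H ((+ m) · α)
  ℕ·-closed zero {α} _ = subst (mem H) (sym (zero-· α)) (zero∈ H)
  ℕ·-closed (suc m) {α} α∈H = subst (mem H) (sym (suc-· m α)) (⊕∈ H α∈H (ℕ·-closed m α∈H))

  ·-closed : ∀ a {α} → mem H α → mem H (a · α)
  ·-closed (+ m) α∈H = ℕ·-closed m α∈H
  ·-closed -[1+ m ] {α} α∈H =
    subst (mem H) (sym (negsuc-· m α)) (neg∈ H (ℕ·-closed (suc m) α∈H))

  lincomb-closed : ∀ {k} (c : Vec ℤ k) {S} → All (mem H) S → mem H (lincomb c S)
  lincomb-closed [] [] = zero∈ H
  lincomb-closed (a ∷ c) (α∈H ∷ S⊆H) = ⊕∈ H (·-closed a α∈H) (lincomb-closed c S⊆H)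

data Generated {n k : ℕ} (S : Vec (Vec ℤ n) k) : Vec ℤ n → Set where
  generator : ∀ i → Generated S (lookup S i)
  zero∈gen  : Generated S (replicate n 0ℤ)
  ⊕∈gen     : ∀ {x y} → Generated S x → Generated S y → Generated S (x ⊕ y)
  neg∈gen   : ∀ {x} → Generated S x → Generated S (neg x)

Span : (G : Graph) {k : ℕ} → Vec (Chain G) k → Subgroup G
Span G S = record { mem = Generated S ; zero∈ = zero∈gen ; ⊕∈ = ⊕∈gen ; neg∈ = neg∈gen }

generators∈Span : ∀ {G k} (S : Vec (Chain G) k) → All (mem (Span G S)) S
generators∈Span S = subst (All (Generated S)) (tabulate∘lookup S) (tabulate⁺ generator)

Span-least : ∀ {G k} (H : Subgroup G) {S : Vec (Chain G) k} →
  All (mem H) S → ∀ {x} → Generated S x → mem H x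
Span-least H S⊆H (generator i) = lookup⁺ S⊆H i
Span-least H S⊆H zero∈gen = zero∈ H
Span-least H S⊆H (⊕∈gen p q) = ⊕∈ H (Span-least H S⊆H p) (Span-least H S⊆H q)
Span-least H S⊆H (neg∈gen p) = neg∈ H (Span-least H S⊆H p)

≈Span-of-basis : ∀ {G k} (H : Subgroup G) (S : Vec (Chain G) k) →
  IsBasis (mem H) S → H ≈S Span G S
≈Span-of-basis {G} H S (S⊆H , spanning , _) x = into , Span-least H S⊆H
  where
  into : mem H x → Generated S x
  into x∈H with spanning x x∈H
  ... | c , refl = lincomb-closed (Span G S) c (generators∈Span {G} S)

ints≤ : ℕ → List ℤ
ints≤ zero = [ + 0 ]
ints≤ (suc h) = + suc h ∷ -[1+ h ] ∷ ints≤ h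

ints≤-complete : ∀ h z → ∣ z ∣ ≤ h → z ∈ ints≤ h
ints≤-complete zero (+ zero) _ = here refl
ints≤-complete (suc h) (+ m) m≤1+h with m ℕP.≟ suc h
... | yes refl = here refl
... | no m≢1+h = there (there (ints≤-complete h (+ m) (ℕP.≤-pred (ℕP.≤∧≢⇒< m≤1+h m≢1+h))))
ints≤-complete (suc h) -[1+ m ] (s≤s m≤h) with m ℕP.≟ h
... | yes refl = there (here refl)
... | no m≢h = there (there (ints≤-complete h -[1+ m ] (ℕP.≤∧≢⇒< m≤h m≢h)))

vectors : ∀ {A : Set} → List A → (n : ℕ) → List (Vec A n)
vectors xs zero = [ [] ]
vectors xs (suc n) = cartesianProductWith _∷_ xs (vectors xs n)

vectors-complete : ∀ {A : Set} {P : A → Set} (xs : List A) → (∀ x → P x → x ∈ xs) →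
  ∀ {n} (v : Vec A n) → All P v → v ∈ vectors xs n
vectors-complete xs _ [] [] = here refl
vectors-complete xs complete (x ∷ v) (px ∷ pv) =
  ∈-cartesianProductWith⁺ _∷_ (complete x px) (vectors-complete xs complete v pv)

coordinates≤norm1 : ∀ {n} h (v : Vec ℤ n) → norm1 v ≤ h → All (λ z → ∣ z ∣ ≤ h) v
coordinates≤norm1 h [] _ = []
coordinates≤norm1 h (x ∷ v) ‖x∷v‖≤h =
  ℕP.m+n≤o⇒m≤o ∣ x ∣ ‖x∷v‖≤h ∷ coordinates≤norm1 h v (ℕP.m+n≤o⇒n≤o ∣ x ∣ ‖x∷v‖≤h)

boundedChains : (n h : ℕ) → List (Vec ℤ n)
boundedChains n h = vectors (ints≤ h) n

boundedChains-complete : ∀ {n} h (v : Vec ℤ n) → norm1 v ≤ h → v ∈ boundedChains n h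
boundedChains-complete h v ‖v‖≤h =
  vectors-complete (ints≤ h) (ints≤-complete h) v (coordinates≤norm1 h v ‖v‖≤h)

mainTheorem12 : (G : Graph) → Connected G → (b : ℕ) → BettiIs G b → (h : ℕ) →
    ∃ λ (L : List (Subgroup G)) →
    ∀ (H : Subgroup G) → IsVanishing H → QuotientRank H 2 → HeightLE b H h →
    ∃ λ K → K ∈ L × H ≈S K
mainTheorem12 G _ b _ h = map (Span G) candidateBases , covers
  where
  candidateBases : List (Vec (Chain G) (b ∸ 2))
  candidateBases = vectors (boundedChains (nE G) h) (b ∸ 2)

  covers : ∀ (H : Subgroup G) → IsVanishing H → QuotientRank H 2 → HeightLE b H h →
    ∃ λ K → K ∈ map (Span G) candidateBases × H ≈S K
  covers H _ _ (S , S-basis , S-bounded) =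
    Span G S ,
    ∈-map⁺ (Span G) (vectors-complete _ (boundedChains-complete h) S S-bounded) ,
    ≈Span-of-basis H S S-basis
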